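{- Let $G$ be a connected graph with $n(G)$ vertices. Then $\beta'(G)=n(G)$ if and only if every vertex of $G$ is a twin vertex.
   Context: For a connected graph $G$, $d(x,y)$ denotes the shortest-path distance. A set $S\subseteq V(G)$ is a resolving set if for every pair of distinct vertices $a,b\in V(G)$ there is $u\in S$ with $d(a,u)\neq d(b,u)$. A resolving set $S$ is a fault-tolerant resolving set if $S\setminus\{x\}$ is a resolving set for every $x\in S$. The fault-tolerant metric dimension $\beta'(G)$ is the minimum cardinality of a fault-tolerant resolving set of $G$. With $N(u)=\{v: uv\in E(G)\}$ and $N[u]=N(u)\cup\{u\}$, distinct vertices $u,v$ are twins if $N(u)=N(v)$ or $N[u]=N[v]$; a vertex $u$ is a twin vertex if there exists $v\neq u$ such that $u$ and $v$ are twins. -}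

module Defs where

open import Data.Nat using (ℕ; zero; suc; _≤_)
open import Data.Fin using (Fin)
open import Data.Fin.Subset using (Subset; _∈_; _-_; ∣_∣)
open import Data.Bool using (Bool; true; false)
open import Data.Product using (Σ; ∃; _×_; _,_)
open import Data.Sum using (_⊎_)
open import Relation.Binary.PropositionalEquality using (_≡_; _≢_)
open import Function.Bundles using (_⇔_)

record Graph (n : ℕ) : Set where
  field
    adj     : Fin n → Fin n → Bool
    symmetric   : ∀ x y → adj x y ≡ adj y x
    irreflexive : ∀ x → adj x x ≡ false

module _ {n : ℕ} (G : Graph n) where
  open Graph G

  Adj : Fin n → Fin n → Set
  Adj x y = adj x y ≡ true

  data Walk : Fin n → Fin n → ℕ → Set where
    here : ∀ {x} → Walk x x zero
    step : ∀ {x y z k} → Adj x y → Walk y z k → Walk x z (suc k)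

  Connected : Set
  Connected = ∀ x y → ∃ λ k → Walk x y k

  Dist : Fin n → Fin n → ℕ → Set
  Dist x y k = Walk x y k × (∀ m → Walk x y m → k ≤ m)

  Distinguishes : Fin n → Fin n → Fin n → Set
  Distinguishes u a b = ∀ k l → Dist a u k → Dist b u l → k ≢ l

  IsResolving : Subset n → Set
  IsResolving S = ∀ a b → a ≢ b → ∃ λ u → u ∈ S × Distinguishes u a b

  IsFaultTolerantResolving : Subset n → Set
  IsFaultTolerantResolving S =
    IsResolving S × (∀ x → x ∈ S → IsResolving (S - x))

  FTMetricDimIs : ℕ → Set
  FTMetricDimIs k =
    (Σ (Subset n) λ S → IsFaultTolerantResolving S × ∣ S ∣ ≡ k)
    × (∀ S → IsFaultTolerantResolving S → k ≤ ∣ S ∣)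

  SameOpenNbhd : Fin n → Fin n → Set
  SameOpenNbhd u v = ∀ w → Adj u w ⇔ Adj v w

  SameClosedNbhd : Fin n → Fin n → Set
  SameClosedNbhd u v = ∀ w → (w ≡ u ⊎ Adj u w) ⇔ (w ≡ v ⊎ Adj v w)

  Twins : Fin n → Fin n → Set
  Twins u v = u ≢ v × (SameOpenNbhd u v ⊎ SameClosedNbhd u v)

  IsTwinVertex : Fin n → Set
  IsTwinVertex u = ∃ λ v → Twins u v

-- Twins u, v satisfy d(u,w) = d(v,w) for every third vertex w, since a shortest walk
-- from u leaving through a neighbour y can leave v through y as well (or v = y).
-- So every resolving set contains u or v, and a fault-tolerant one contains both:
-- if all vertices are twins, only V itself is fault-tolerant resolving.
-- Conversely, if u has no twin, then for each x ≠ u some third vertex w is adjacent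
-- to exactly one of u, x and hence distinguishes them; every other pair is
-- distinguished by one of its own members, so V ∖ {u} is fault-tolerant resolving
-- and β'(G) < n.
module Submission where

open import Defs
open import Data.Nat using (ℕ; zero; suc; _≤_; _<_; z≤n; s≤s)
open import Data.Nat.Properties using (≤-antisym; ≤-trans; ≤-refl; n≤1+n; <-irrefl; ≤-<-trans; ≮⇒≥; m<1+n⇒m<n∨m≡n)
open import Data.Fin using (Fin; zero; suc; _≟_)
open import Data.Fin.Subset using (Subset; _∈_; _∉_; _-_; ∣_∣; ⊤; ⁅_⁆)
open import Data.Fin.Subset.Properties using (_∈?_; ∈⊤; ∣⊤∣≡n; p⊆q⇒∣p∣≤∣q∣; p─q⊆p; x∈p∧x≢y⇒x∈p-y; x∈p⇒∣p-x∣<∣p∣)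
open import Data.Fin.Properties using (any?; all?; ¬∀⟶∃¬)
open import Data.Bool using (true; false)
import Data.Bool.Properties as Bool
open import Data.Vec.Base using (_∷_; here; there)
open import Data.Product using (∃; _×_; _,_; proj₁; proj₂)
open import Data.Sum using (_⊎_; inj₁; inj₂; [_,_]′)
open import Relation.Nullary using (¬_; Dec; yes; no; contradiction)
open import Relation.Nullary.Decidable using (_×-dec_; _⊎-dec_; ¬?)
open import Relation.Unary using (Decidable)
open import Relation.Binary.PropositionalEquality using (_≡_; _≢_; refl; sym; trans; subst; ≢-sym)
open import Function.Base using (case_of_)
open import Function.Bundles using (_⇔_; mk⇔; module Equivalence)
open import Function.Properties.Equivalence using () renaming (sym to ⇔-sym)

IsLeast : (ℕ → Set) → ℕ → Set
IsLeast P k = P k × (∀ j → P j → k ≤ j)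

least-or-absent : ∀ {P} → Decidable P → ∀ m → ∃ (IsLeast P) ⊎ (∀ j → j < m → ¬ P j)
least-or-absent P? zero = inj₂ λ _ ()
least-or-absent P? (suc m) with least-or-absent P? m
... | inj₁ least = inj₁ least
... | inj₂ absent with P? m
...   | yes pm = inj₁ (m , pm , λ j pj → ≮⇒≥ λ j<m → absent j j<m pj)
...   | no ¬pm = inj₂ λ j j<1+m → [ absent j , (λ { refl → ¬pm }) ]′ (m<1+n⇒m<n∨m≡n j<1+m)

∃-least : ∀ {P} → Decidable P → ∀ {m} → P m → ∃ (IsLeast P)
∃-least P? {m} pm with least-or-absent P? (suc m)
... | inj₁ least  = least
... | inj₂ absent = contradiction pm (absent m ≤-refl)

x∉p-x : ∀ {n} (p : Subset n) x → x ∉ p - x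
x∉p-x (_ ∷ p) zero    ()
x∉p-x (_ ∷ p) (suc x) (there x∈p-x) = x∉p-x p x x∈p-x

x∈p-y⇒x≢y : ∀ {n} {p : Subset n} {x y} → x ∈ p - y → x ≢ y
x∈p-y⇒x≢y {p = p} {x} x∈p-y refl = x∉p-x p x x∈p-y

x∈p∧x∉p-y⇒x≡y : ∀ {n} {p : Subset n} {x y} → x ∈ p → x ∉ p - y → x ≡ y
x∈p∧x∉p-y⇒x≡y {x = x} {y} x∈p x∉p-y with x ≟ y
... | yes x≡y = x≡y
... | no  x≢y = contradiction (x∈p∧x≢y⇒x∈p-y x∈p x≢y) x∉p-y

x∈p∧x∉p-y-z⇒x≡y⊎x≡z : ∀ {n} {p : Subset n} {x y z} → x ∈ p → x ∉ p - y - z → x ≡ y ⊎ x ≡ z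
x∈p∧x∉p-y-z⇒x≡y⊎x≡z {p = p} {x} {y} x∈p x∉p-y-z with x ∈? p - y
... | yes x∈p-y = inj₂ (x∈p∧x∉p-y⇒x≡y x∈p-y x∉p-y-z)
... | no  x∉p-y = inj₁ (x∈p∧x∉p-y⇒x≡y x∈p x∉p-y)

∣⊤-x∣<n : ∀ {n} (x : Fin n) → ∣ ⊤ - x ∣ < n
∣⊤-x∣<n {n} x = subst (∣ ⊤ - x ∣ <_) (∣⊤∣≡n n) (x∈p⇒∣p-x∣<∣p∣ (∈⊤ {x = x}))

∀x∈p⇒n≤∣p∣ : ∀ {n} {p : Subset n} → (∀ x → x ∈ p) → n ≤ ∣ p ∣
∀x∈p⇒n≤∣p∣ {n} {p} ∀x∈p = subst (_≤ ∣ p ∣) (∣⊤∣≡n n) (p⊆q⇒∣p∣≤∣q∣ {p = ⊤} λ {x} _ → ∀x∈p x)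

module _ {n : ℕ} (G : Graph n) where
  open Graph G

  walk? : ∀ x y → Decidable (Walk G x y)
  walk? x y zero with x ≟ y
  ... | yes refl = yes here
  ... | no  x≢y  = no λ { here → x≢y refl }
  walk? x y (suc k) with any? (λ z → (adj x z Bool.≟ true) ×-dec walk? z y k)
  ... | yes (z , xz , zy) = yes (step xz zy)
  ... | no  ∄z            = no λ { (step {y = z} xz zy) → ∄z (z , xz , zy) }

  -- Dist G x y is IsLeast (Walk G x y) on the nose.
  ∃-dist : Connected G → ∀ x y → ∃ (Dist G x y)
  ∃-dist connected x y = ∃-least (walk? x y) (proj₂ (connected x y))

  Adj-sym : ∀ {x y} → Adj G x y → Adj G y x
  Adj-sym {x} {y} x~y = trans (symmetric y x) x~y

  walk-zero⇒≡ : ∀ {x y} → Walk G x y 0 → x ≡ y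
  walk-zero⇒≡ here = refl

  walk-one⇒Adj : ∀ {x y} → Walk G x y 1 → Adj G x y
  walk-one⇒Adj (step xy here) = xy

  Distinguishes-sym : ∀ {w a b} → Distinguishes G w a b → Distinguishes G w b a
  Distinguishes-sym D k l da db k≡l = D l k db da (sym k≡l)

  distinguishes-self : ∀ {a b} → a ≢ b → Distinguishes G a a b
  distinguishes-self a≢b k .k (_ , shortest) (walk , _) refl with shortest 0 here
  ... | z≤n = a≢b (sym (walk-zero⇒≡ walk))

  adjacent-distinguishes : ∀ {a b w} → Adj G a w → adj b w ≡ false → Distinguishes G w a b
  adjacent-distinguishes {a} a~w _ zero _ (walk , _) _ _
    with refl ← walk-zero⇒≡ walk = contradiction (trans (sym (irreflexive a)) a~w) λ ()
  adjacent-distinguishes _ b≁w (suc zero) .1 _ (walk , _) refl =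
    contradiction (trans (sym b≁w) (walk-one⇒Adj walk)) λ ()
  adjacent-distinguishes a~w _ (suc (suc k)) _ (_ , shortest) _ _ with shortest 1 (step a~w here)
  ... | s≤s ()

  adj-differs⇒distinguishes : ∀ {a b w} → adj a w ≢ adj b w → Distinguishes G w a b
  adj-differs⇒distinguishes {a} {b} {w} ≢adj with adj a w in aw | adj b w in bw
  ... | true  | false = adjacent-distinguishes aw bw
  ... | false | true  = Distinguishes-sym (adjacent-distinguishes bw aw)
  ... | true  | true  = contradiction refl ≢adj
  ... | false | false = contradiction refl ≢adj

  Twins-sym : ∀ {u v} → Twins G u v → Twins G v u
  Twins-sym (u≢v , inj₁ open≡)   = ≢-sym u≢v , inj₁ λ w → ⇔-sym (open≡ w)
  Twins-sym (u≢v , inj₂ closed≡) = ≢-sym u≢v , inj₂ λ w → ⇔-sym (closed≡ w)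

  twin-shortcut : ∀ {u v w m} → Twins G u v → w ≢ u → Walk G u w m →
                  ∃ λ m′ → m′ ≤ m × Walk G v w m′
  twin-shortcut _ w≢u here = contradiction refl w≢u
  twin-shortcut (_ , inj₁ open≡) _ (step {y = y} u~y walk) =
    _ , ≤-refl , step (Equivalence.to (open≡ y) u~y) walk
  twin-shortcut (_ , inj₂ closed≡) _ (step {y = y} u~y walk) with Equivalence.to (closed≡ y) (inj₂ u~y)
  ... | inj₁ refl = _ , n≤1+n _ , walk
  ... | inj₂ v~y  = _ , ≤-refl , step v~y walk

  twins⇒equidistant : ∀ {u v w k l} → Twins G u v → w ≢ u → w ≢ v →
                      Dist G u w k → Dist G v w l → k ≡ l
  twins⇒equidistant twins w≢u w≢v (walkᵤ , shortestᵤ) (walkᵥ , shortestᵥ)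
    with _ , k′≤k , walkᵥ′ ← twin-shortcut twins w≢u walkᵤ
       | _ , l′≤l , walkᵤ′ ← twin-shortcut (Twins-sym twins) w≢v walkᵥ
    = ≤-antisym (≤-trans (shortestᵤ _ walkᵤ′) l′≤l) (≤-trans (shortestᵥ _ walkᵥ′) k′≤k)

  twins-undistinguished : Connected G → ∀ {u v w} → Twins G u v → w ≢ u → w ≢ v →
                          ¬ Distinguishes G w u v
  twins-undistinguished connected {u} {v} {w} twins w≢u w≢v D
    with k , distᵤ ← ∃-dist connected u w | l , distᵥ ← ∃-dist connected v w
    = D k l distᵤ distᵥ (twins⇒equidistant twins w≢u w≢v distᵤ distᵥ)

  AdjAgreeAt : Fin n → Fin n → Fin n → Set
  AdjAgreeAt u x w = w ≡ u ⊎ w ≡ x ⊎ adj u w ≡ adj x w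

  AdjAgreeOutside : Fin n → Fin n → Set
  AdjAgreeOutside u x = ∀ w → AdjAgreeAt u x w

  ResolvedOutside : Fin n → Fin n → Set
  ResolvedOutside u x = ∃ λ w → w ≢ u × w ≢ x × Distinguishes G w u x

  agree-nonadjacent⇒SameOpenNbhd : ∀ {u x} → adj u x ≡ false → AdjAgreeOutside u x →
                                   SameOpenNbhd G u x
  agree-nonadjacent⇒SameOpenNbhd {u} {x} u≁x agree w =
    mk⇔ (trans (sym (adj≡ w))) (trans (adj≡ w))
    where
    adj≡ : ∀ w → adj u w ≡ adj x w
    adj≡ w with agree w
    ... | inj₁ refl        = trans (irreflexive u) (sym (trans (symmetric x u) u≁x))
    ... | inj₂ (inj₁ refl) = trans u≁x (sym (irreflexive x))
    ... | inj₂ (inj₂ eq)   = eq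

  agree-adjacent⇒SameClosedNbhd : ∀ {u x} → Adj G u x → AdjAgreeOutside u x →
                                  SameClosedNbhd G u x
  agree-adjacent⇒SameClosedNbhd {u} {x} u~x agree w with agree w
  ... | inj₁ refl        = mk⇔ (λ _ → inj₂ (Adj-sym u~x)) (λ _ → inj₁ refl)
  ... | inj₂ (inj₁ refl) = mk⇔ (λ _ → inj₁ refl) (λ _ → inj₂ u~x)
  ... | inj₂ (inj₂ eq)   = mk⇔ (λ { (inj₁ refl) → inj₂ (Adj-sym u~x)
                                  ; (inj₂ u~w)  → inj₂ (trans (sym eq) u~w) })
                               (λ { (inj₁ refl) → inj₂ u~x
                                  ; (inj₂ x~w)  → inj₂ (trans eq x~w) })

  agree⇒Twins : ∀ {u x} → u ≢ x → AdjAgreeOutside u x → Twins G u x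
  agree⇒Twins {u} {x} u≢x agree with adj u x in ux
  ... | false = u≢x , inj₁ (agree-nonadjacent⇒SameOpenNbhd ux agree)
  ... | true  = u≢x , inj₂ (agree-adjacent⇒SameClosedNbhd ux agree)

  adjAgreeAt? : ∀ u x w → Dec (AdjAgreeAt u x w)
  adjAgreeAt? u x w = (w ≟ u) ⊎-dec (w ≟ x) ⊎-dec (adj u w Bool.≟ adj x w)

  ¬agree⇒ResolvedOutside : ∀ {u x} → ¬ AdjAgreeOutside u x → ResolvedOutside u x
  ¬agree⇒ResolvedOutside {u} {x} ¬agree with w , disagree ← ¬∀⟶∃¬ n _ (adjAgreeAt? u x) ¬agree =
    w , (λ w≡u → disagree (inj₁ w≡u)) , (λ w≡x → disagree (inj₂ (inj₁ w≡x))) ,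
    adj-differs⇒distinguishes (λ adj≡ → disagree (inj₂ (inj₂ adj≡)))

  twinVertex-or-resolvedOutside : ∀ u → IsTwinVertex G u ⊎ (∀ x → u ≢ x → ResolvedOutside u x)
  twinVertex-or-resolvedOutside u with any? (λ x → ¬? (u ≟ x) ×-dec all? (adjAgreeAt? u x))
  ... | yes (x , u≢x , agree) = inj₁ (x , agree⇒Twins u≢x agree)
  ... | no  ∄agree            = inj₂ λ x u≢x → ¬agree⇒ResolvedOutside λ agree → ∄agree (x , u≢x , agree)

  resolving-if-outsiders-resolved :
    ∀ S → (∀ a b → a ≢ b → a ∉ S → b ∉ S → ∃ λ w → w ∈ S × Distinguishes G w a b) →
    IsResolving G S
  resolving-if-outsiders-resolved S resolve a b a≢b with a ∈? S | b ∈? S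
  ... | yes a∈S | _       = a , a∈S , distinguishes-self a≢b
  ... | no  _   | yes b∈S = b , b∈S , Distinguishes-sym (distinguishes-self (≢-sym a≢b))
  ... | no  a∉S | no  b∉S = resolve a b a≢b a∉S b∉S

  ⊤-resolving : IsResolving G ⊤
  ⊤-resolving = resolving-if-outsiders-resolved ⊤ λ _ _ _ a∉⊤ _ → contradiction ∈⊤ a∉⊤

  ⊤-x-resolving : ∀ x → IsResolving G (⊤ - x)
  ⊤-x-resolving x = resolving-if-outsiders-resolved (⊤ - x) λ a b a≢b a∉ b∉ →
    contradiction (trans (x∈p∧x∉p-y⇒x≡y ∈⊤ a∉) (sym (x∈p∧x∉p-y⇒x≡y ∈⊤ b∉))) a≢b

  ⊤-faultTolerantResolving : IsFaultTolerantResolving G ⊤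
  ⊤-faultTolerantResolving = ⊤-resolving , λ x _ → ⊤-x-resolving x

  ⊤-u-x-resolving : ∀ {u x} → ResolvedOutside u x → IsResolving G (⊤ - u - x)
  ⊤-u-x-resolving {u} {x} (w , w≢u , w≢x , D) =
    resolving-if-outsiders-resolved (⊤ - u - x) λ a b a≢b a∉ b∉ →
      case x∈p∧x∉p-y-z⇒x≡y⊎x≡z ∈⊤ a∉ , x∈p∧x∉p-y-z⇒x≡y⊎x≡z ∈⊤ b∉ of λ where
        (inj₁ refl , inj₁ refl) → contradiction refl a≢b
        (inj₁ refl , inj₂ refl) → w , w∈ , D
        (inj₂ refl , inj₁ refl) → w , w∈ , Distinguishes-sym D
        (inj₂ refl , inj₂ refl) → contradiction refl a≢b
    where
    w∈ : w ∈ ⊤ - u - x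
    w∈ = x∈p∧x≢y⇒x∈p-y (x∈p∧x≢y⇒x∈p-y ∈⊤ w≢u) w≢x

  ⊤-u-faultTolerantResolving : ∀ {u} → (∀ x → u ≢ x → ResolvedOutside u x) →
                               IsFaultTolerantResolving G (⊤ - u)
  ⊤-u-faultTolerantResolving {u} resolved =
    ⊤-x-resolving u , λ x x∈⊤-u → ⊤-u-x-resolving (resolved x (≢-sym (x∈p-y⇒x≢y x∈⊤-u)))

  resolving-meets-twins : Connected G → ∀ {S u v} → IsResolving G S → Twins G u v → u ∈ S ⊎ v ∈ S
  resolving-meets-twins connected {S} {u} {v} resolving twins
    with w , w∈S , D ← resolving u v (proj₁ twins) | w ≟ u | w ≟ v
  ... | yes refl | _        = inj₁ w∈S
  ... | no  _    | yes refl = inj₂ w∈S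
  ... | no  w≢u  | no  w≢v  = contradiction D (twins-undistinguished connected twins w≢u w≢v)

  faultTolerantResolving-contains-twinVertex :
    Connected G → ∀ {S u} → IsFaultTolerantResolving G S → IsTwinVertex G u → u ∈ S
  faultTolerantResolving-contains-twinVertex connected {S} (resolving , resolving-v) (v , twins)
    with resolving-meets-twins connected resolving twins
  ... | inj₁ u∈S = u∈S
  ... | inj₂ v∈S with resolving-meets-twins connected (resolving-v v v∈S) twins
  ...   | inj₁ u∈S-v = p─q⊆p S ⁅ v ⁆ u∈S-v
  ...   | inj₂ v∈S-v = contradiction refl (x∈p-y⇒x≢y v∈S-v)

proposition2p2 : (n : ℕ) (G : Graph n) → Connected G →
    FTMetricDimIs G n ⇔ (∀ u → IsTwinVertex G u)
proposition2p2 n G connected = mk⇔ dim≡n⇒allTwins allTwins⇒dim≡n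
  where
  dim≡n⇒allTwins : FTMetricDimIs G n → ∀ u → IsTwinVertex G u
  dim≡n⇒allTwins (_ , minimal) u with twinVertex-or-resolvedOutside G u
  ... | inj₁ twin     = twin
  ... | inj₂ resolved =
    contradiction (≤-<-trans (minimal _ (⊤-u-faultTolerantResolving G resolved)) (∣⊤-x∣<n u))
                  (<-irrefl refl)

  allTwins⇒dim≡n : (∀ u → IsTwinVertex G u) → FTMetricDimIs G n
  allTwins⇒dim≡n twin =
    (⊤ , ⊤-faultTolerantResolving G , ∣⊤∣≡n n) ,
    λ S ft → ∀x∈p⇒n≤∣p∣ λ u → faultTolerantResolving-contains-twinVertex G connected ft (twin u)
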